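{- Let $\mathcal{P}$ be a profile of unrooted phylogenetic trees whose display graph $G(\mathcal{P})$ is connected, and let $F_1,F_2$ be two parallel nice minimal cuts of $G(\mathcal{P})$. Then the splits $\sigma(F_1)$ and $\sigma(F_2)$ are compatible.
   Context: A phylogenetic tree $T$ is an unrooted tree whose leaves are bijectively labelled by a finite set $\mathcal{L}(T)$; leaves are identified with labels. A profile is a finite collection $\mathcal{P}=\{T_1,\dots,T_k\}$ of phylogenetic trees with pairwise disjoint sets of internal vertices; $\mathcal{L}(\mathcal{P})=\bigcup_i\mathcal{L}(T_i)$. The display graph $G(\mathcal{P})$ has vertex set $\bigcup_iV(T_i)$ and edge set $\bigcup_iE(T_i)$; for a subgraph $H$, $\mathcal{L}(H)$ is the set of labels that are vertices of $H$. A cut of a connected graph $G$ is $F\subseteq E(G)$ with $G-F$ disconnected; minimal if no proper subset is a cut (then $G-F$ has exactly two components). Cuts $F,F'$ are parallel if $G-F$ has at most one connected component $H$ with $E(H)\cap F'\neq\emptyset$. A cut $F$ of $G(\mathcal{P})$ is nice if for each $T\in\mathcal{P}$ the edges of $T$ in $F$ are all incident to a common vertex of $T$, and each component of $G(\mathcal{P})-F$ has at least one edge. For a nice minimal cut $F$ with components $G_1,G_2$ of $G(\mathcal{P})-F$, $\sigma(F)$ is the split $\mathcal{L}(G_1)|\mathcal{L}(G_2)$ of $\mathcal{L}(\mathcal{P})$. Two splits $A_1|A_2$ and $B_1|B_2$ of the same set are compatible if some phylogenetic tree displays both (equivalently, at least one of $A_i\cap B_j$, $i,j\in\{1,2\}$,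 is empty). -}

module Defs where

open import Data.Nat using (ℕ; _≥_)
open import Data.Fin using (Fin)
open import Data.Bool using (Bool; true; false; T)
open import Data.List using (List; []; _∷_; _++_; length)
open import Data.List.Relation.Unary.Unique.Propositional using (Unique)
open import Data.Product using (Σ; ∃; ∃-syntax; _×_; _,_)
open import Data.Sum using (_⊎_)
open import Data.Unit using (⊤)
open import Data.Empty using (⊥)
open import Relation.Nullary using (¬_)
open import Relation.Binary.PropositionalEquality using (_≡_; _≢_)
open import Relation.Binary.Construct.Closure.ReflexiveTransitive using (Star)

-- Generic graph notions.  Vertices are Fin N; a (simple, undirected)
-- edge set is a symmetric Bool-valued relation (edges = unordered pairs).

Rel₀ : ℕ → Set₁
Rel₀ N = Fin N → Fin N → Set

Reach : {N : ℕ} → Rel₀ N → Rel₀ N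
Reach R = Star R

Chain : {N : ℕ} → Rel₀ N → List (Fin N) → Set
Chain R [] = ⊤
Chain R (x ∷ []) = ⊤
Chain R (x ∷ y ∷ r) = R x y × Chain R (y ∷ r)

HasCycle : {N : ℕ} → Rel₀ N → Set
HasCycle {N} R = Σ (Fin N) λ x → Σ (List (Fin N)) λ xs →
  (length xs ≥ 2) × Unique (x ∷ xs) × Chain R (x ∷ xs ++ x ∷ [])

record IsTree {N : ℕ} (vert : Fin N → Bool) (adj : Fin N → Fin N → Bool) : Set where
  field
    nonempty  : ∃[ v ] T (vert v)
    edgesIn   : ∀ u v → T (adj u v) → T (vert u) × T (vert v)
    symmetric : ∀ u v → T (adj u v) → T (adj v u)
    irrefl    : ∀ v → ¬ T (adj v v)
    connected : ∀ u v → T (vert u) → T (vert v) → Reach (λ a b → T (adj a b)) u v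
    acyclic   : ¬ HasCycle (λ a b → T (adj a b))

-- v is a leaf of the tree (degree ≤ 1; in a tree with ≥ 2 vertices this
-- is degree exactly 1, in the one-vertex tree the vertex is the leaf)
IsLeaf : {N : ℕ} → (Fin N → Bool) → (Fin N → Fin N → Bool) → Fin N → Set
IsLeaf vert adj v = T (vert v) × (∀ w w' → T (adj v w) → T (adj v w') → w ≡ w')

-- Profiles.  All trees live on the common vertex type Fin N (this is
-- the vertex set of the display graph).  lab marks the vertices which are
-- labels (leaves are identified with their labels).

record Profile (N : ℕ) : Set where
  field
    k    : ℕ
    vert : Fin k → Fin N → Bool
    adj  : Fin k → Fin N → Fin N → Bool
    lab  : Fin N → Bool

record IsProfile {N : ℕ} (P : Profile N) : Set where
  open Profile P
  field
    trees     : ∀ i → IsTree (vert i) (adj i)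
    leafLab   : ∀ i v → T (vert i v) → (T (lab v) → IsLeaf (vert i) (adj i) v)
                                      × (IsLeaf (vert i) (adj i) v → T (lab v))
    -- the vertex set of G(P) is the union of the V(T_i)
    covers    : ∀ v → ∃[ i ] T (vert i v)
    disjoint  : ∀ i j v → i ≢ j → T (vert i v) → T (vert j v) → T (lab v)

module _ {N : ℕ} (P : Profile N) where
  open Profile P

  GAdj : Rel₀ N
  GAdj u v = ∃[ i ] T (adj i u v)

  Connected : Set
  Connected = ∀ u v → Reach GAdj u v

  IsEdgeSet : (Fin N → Fin N → Bool) → Set
  IsEdgeSet F = (∀ u v → T (F u v) → T (F v u)) × (∀ u v → T (F u v) → GAdj u v)

  Del : (Fin N → Fin N → Bool) → Rel₀ N
  Del F u v = GAdj u v × ¬ T (F u v)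

  IsCut : (Fin N → Fin N → Bool) → Set
  IsCut F = IsEdgeSet F × ¬ (∀ u v → Reach (Del F) u v)

  IsMinimalCut : (Fin N → Fin N → Bool) → Set
  IsMinimalCut F = IsCut F ×
    (∀ F' → IsEdgeSet F' → (∀ u v → T (F' u v) → T (F u v))
          → (∃[ u ] ∃[ v ] (T (F u v) × ¬ T (F' u v))) → ¬ IsCut F')

  IsNiceCut : (Fin N → Fin N → Bool) → Set
  IsNiceCut F = IsCut F
    × (∀ i → ∃[ v ] (T (vert i v) ×
          (∀ a b → T (F a b) → T (adj i a b) → (a ≡ v) ⊎ (b ≡ v))))
    × (∀ x → ∃[ y ] ∃[ z ] (Reach (Del F) x y × Del F y z))

  -- parallel: at most one component H of G − F has an F'-edge in E(H);
  -- i.e. any two edges of G − F lying in F' are in the same component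
  Parallel : (Fin N → Fin N → Bool) → (Fin N → Fin N → Bool) → Set
  Parallel F F' = ∀ a b c d → Del F a b → T (F' a b) → Del F c d → T (F' c d)
                  → Reach (Del F) a c

  -- the side of σ(F) given by the component of G − F containing x:
  -- the labels in that component
  SplitSide : (Fin N → Fin N → Bool) → Fin N → Fin N → Set
  SplitSide F x l = T (lab l) × Reach (Del F) x l

  SplitsCompatible : (Fin N → Fin N → Bool) → (Fin N → Fin N → Bool) → Set
  SplitsCompatible F₁ F₂ = ∃[ x ] ∃[ y ] (∀ l → SplitSide F₁ x l → SplitSide F₂ y l → ⊥)

-- Some component C₁ of G − F₁ contains no F₂-edge: if G − F₁ has an F₂-edge at all,
-- parallelism puts every such edge in a single component, and a cut has a second one.
-- Then C₁ is connected in G − F₂, so it lies inside one component of G − F₂; any other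
-- component C₂ of G − F₂ is disjoint from C₁, hence so are their label sets, which are
-- sides of σ(F₁) and σ(F₂).
module Submission where

open import Defs
open import Data.Nat using (ℕ; zero; suc; _<_; s≤s)
open import Data.Nat.Properties using (m≤n⇒m<n∨m≡n)
open import Data.Fin using (Fin; toℕ; _≟_)
open import Data.Fin.Properties using (any?; all?; ¬∀⟶∃¬; toℕ<n; toℕ-injective)
open import Data.Bool using (Bool; T)
open import Data.Bool.Properties using (T?)
open import Data.Product using (∃-syntax; _×_; _,_; proj₁)
open import Data.Sum using (_⊎_; inj₁; inj₂)
open import Relation.Nullary using (¬_; yes; no)
open import Relation.Nullary.Decidable using (_×-dec_; _⊎-dec_; ¬?)
open import Relation.Binary using (Decidable; Symmetric)
open import Relation.Binary.PropositionalEquality using (_≡_; refl; sym; trans; subst)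
open import Relation.Binary.Construct.Closure.ReflexiveTransitive using (Star; ε; _◅_; _◅◅_; reverse)

module FloydWarshall {N : ℕ} (R : Rel₀ N) (R? : Decidable R) where

  -- an R-path from x to y all of whose interior vertices have index below k
  PathVia : ℕ → Rel₀ N
  PathVia zero    x y = x ≡ y ⊎ R x y
  PathVia (suc k) x y = PathVia k x y ⊎ ∃[ v ] (toℕ v ≡ k × PathVia k x v × PathVia k v y)

  PathVia? : ∀ k → Decidable (PathVia k)
  PathVia? zero    x y = (x ≟ y) ⊎-dec R? x y
  PathVia? (suc k) x y = PathVia? k x y
    ⊎-dec any? (λ v → (toℕ v Data.Nat.≟ k) ×-dec (PathVia? k x v ×-dec PathVia? k v y))

  PathVia⇒Star : ∀ k {x y} → PathVia k x y → Star R x y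
  PathVia⇒Star zero    (inj₁ refl)               = ε
  PathVia⇒Star zero    (inj₂ r)                  = r ◅ ε
  PathVia⇒Star (suc k) (inj₁ p)                  = PathVia⇒Star k p
  PathVia⇒Star (suc k) (inj₂ (_ , _ , p , q))    = PathVia⇒Star k p ◅◅ PathVia⇒Star k q

  PathVia-weaken : ∀ k {x y} → PathVia zero x y → PathVia k x y
  PathVia-weaken zero    p = p
  PathVia-weaken (suc k) p = inj₁ (PathVia-weaken k p)

  PathVia-shrinkʳ : ∀ k {x z} → toℕ z ≡ k → PathVia (suc k) x z → PathVia k x z
  PathVia-shrinkʳ k z≡k (inj₁ p)                 = p
  PathVia-shrinkʳ k z≡k (inj₂ (_ , v≡k , p , _)) = subst (PathVia k _) (toℕ-injective (trans v≡k (sym z≡k))) p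

  PathVia-shrinkˡ : ∀ k {z y} → toℕ z ≡ k → PathVia (suc k) z y → PathVia k z y
  PathVia-shrinkˡ k z≡k (inj₁ p)                 = p
  PathVia-shrinkˡ k z≡k (inj₂ (_ , v≡k , _ , q)) =
    subst (λ w → PathVia k w _) (toℕ-injective (trans v≡k (sym z≡k))) q

  PathVia-trans : ∀ k {x z y} → toℕ z < k → PathVia k x z → PathVia k z y → PathVia k x y
  PathVia-trans (suc k) {z = z} (s≤s z≤k) p q with m≤n⇒m<n∨m≡n z≤k
  ... | inj₂ z≡k = inj₂ (z , z≡k , PathVia-shrinkʳ k z≡k p , PathVia-shrinkˡ k z≡k q)
  ... | inj₁ z<k with p | q
  ... | inj₁ p′                  | inj₁ q′                    = inj₁ (PathVia-trans k z<k p′ q′)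
  ... | inj₁ p′                  | inj₂ (v , v≡k , q₁ , q₂)   = inj₂ (v , v≡k , PathVia-trans k z<k p′ q₁ , q₂)
  ... | inj₂ (v , v≡k , p₁ , p₂) | inj₁ q′                    = inj₂ (v , v≡k , p₁ , PathVia-trans k z<k p₂ q′)
  ... | inj₂ (v , v≡k , p₁ , _)  | inj₂ (v′ , v′≡k , _ , q₂)  =
    inj₂ (v , v≡k , p₁ , subst (λ w → PathVia k w _) (toℕ-injective (trans v′≡k (sym v≡k))) q₂)

  Star⇒PathVia : ∀ {x y} → Star R x y → PathVia N x y
  Star⇒PathVia ε                = PathVia-weaken N (inj₁ refl)
  Star⇒PathVia (_◅_ {j = z} r rs) =
    PathVia-trans N (toℕ<n z) (PathVia-weaken N (inj₂ r)) (Star⇒PathVia rs)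

  Star? : Decidable (Star R)
  Star? x y with PathVia? N x y
  ... | yes p = yes (PathVia⇒Star N p)
  ... | no ¬p = no (λ s → ¬p (Star⇒PathVia s))

module _ {N : ℕ} {R : Rel₀ N} (R? : Decidable R) (R-sym : Symmetric R) where
  open FloydWarshall R R?

  unreachable-pair : ¬ (∀ u v → Star R u v) → ∃[ p ] ∃[ q ] ¬ Star R p q
  unreachable-pair disc with ¬∀⟶∃¬ N _ (λ u → all? (Star? u)) disc
  ... | p , ¬p↠ with ¬∀⟶∃¬ N _ (Star? p) ¬p↠
  ... | q , ¬p↠q = p , q , ¬p↠q

  unreachable-from : ¬ (∀ u v → Star R u v) → ∀ a → ∃[ u ] ¬ Star R a u
  unreachable-from disc a with unreachable-pair disc
  ... | p , q , ¬p↠q with Star? a p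
  ...   | yes a↠p = q , λ a↠q → ¬p↠q (reverse R-sym a↠p ◅◅ a↠q)
  ...   | no ¬a↠p = p , ¬a↠p

module _ {N : ℕ} (P : Profile N) (isP : IsProfile P) where
  open Profile P
  open IsProfile isP

  GAdj? : Decidable (GAdj P)
  GAdj? u v = any? (λ i → T? (adj i u v))

  Del? : ∀ F → Decidable (Del P F)
  Del? F u v = GAdj? u v ×-dec ¬? (T? (F u v))

  GAdj-sym : Symmetric (GAdj P)
  GAdj-sym (i , e) = i , IsTree.symmetric (trees i) _ _ e

  Del-sym : ∀ {F} → IsEdgeSet P F → Symmetric (Del P F)
  Del-sym (F-sym , _) (g , ∉F) = GAdj-sym g , λ f → ∉F (F-sym _ _ f)

  ComponentAvoids : (F₁ F₂ : Fin N → Fin N → Bool) → Fin N → Set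
  ComponentAvoids F₁ F₂ u = ∀ {w z} → Star (Del P F₁) u w → Del P F₁ w z → ¬ T (F₂ w z)

  ComponentAvoids⇒Star-Del : ∀ {F₁ F₂ u} → ComponentAvoids F₁ F₂ u
                           → ∀ {l} → Star (Del P F₁) u l → Star (Del P F₂) u l
  ComponentAvoids⇒Star-Del {F₁} {F₂} {u} avoids = go ε
    where
    go : ∀ {w l} → Star (Del P F₁) u w → Star (Del P F₁) w l → Star (Del P F₂) w l
    go u↠w ε                    = ε
    go u↠w (e@(g , _) ◅ w′↠l) = (g , avoids u↠w e) ◅ go (u↠w ◅◅ e ◅ ε) w′↠l

  avoiding-component : ∀ {F₁ F₂} → IsCut P F₁ → Parallel P F₁ F₂ → ∃[ x ] ComponentAvoids F₁ F₂ x
  avoiding-component {F₁} {F₂} (es , disc) par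
    with any? (λ a → any? (λ b → Del? F₁ a b ×-dec T? (F₂ a b)))
  ... | no ¬edge = proj₁ (unreachable-pair (Del? F₁) (Del-sym es) disc) ,
                   λ {w} {z} _ e f → ¬edge (w , z , e , f)
  ... | yes (a , b , e , f) with unreachable-from (Del? F₁) (Del-sym es) disc a
  ... | u , ¬a↠u = u , λ {w} {z} u↠w e′ f′ → ¬a↠u (par a b w z e f e′ f′ ◅◅ reverse (Del-sym es) u↠w)

lemma11 : (N : ℕ) (P : Profile N) → IsProfile P → Connected P
    → (F₁ F₂ : Fin N → Fin N → Bool)
    → IsNiceCut P F₁ → IsMinimalCut P F₁
    → IsNiceCut P F₂ → IsMinimalCut P F₂
    → Parallel P F₁ F₂
    → SplitsCompatible P F₁ F₂
lemma11 N P isP _ F₁ F₂ (cut₁ , _) _ (cut₂@(es₂ , disc₂) , _) _ par with avoiding-component P isP cut₁ par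
... | x , avoids with unreachable-from (Del? P isP F₂) (Del-sym P isP es₂) disc₂ x
... | y , ¬x↠y = x , y , λ l (_ , x↠l) (_ , y↠l) →
  ¬x↠y (ComponentAvoids⇒Star-Del P isP avoids x↠l ◅◅ reverse (Del-sym P isP es₂) y↠l)
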